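{- Let $d\in\mathbb N$ and let $\prec$ be an order on $\mathbb Q^{(d)}_<$ which is first-order definable in $\mathbb Q_d$. Then there are $R_1,\dots,R_d\in\{<,>\}$ and a permutation $\sigma$ of $[d]$ such that for all $\bar a,\bar b\in\mathbb Q^{(d)}_<$ we have $\bar a\prec\bar b$ if and only if there exists $j\le d$ such that $a_{\sigma(i)}=b_{\sigma(i)}$ for all $i<j$ and $a_{\sigma(j)}R_jb_{\sigma(j)}$.
   Context: $\mathbb Q^{(d)}_<=\{(a_1,\dots,a_d)\in\mathbb Q^d: a_1<\dots<a_d\}$. $\mathbb Q_d$ denotes the structure with domain $\mathbb Q^{(d)}_<$ and the binary relations $<_{ij}$ and $=_{ij}$ for $i,j\in[d]$, where $\bar a<_{ij}\bar b$ iff $a_i<b_j$ and $\bar a=_{ij}\bar b$ iff $a_i=b_j$. Here "order" means a strict linear order, and definability is without parameters. -}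

module Defs where

open import Data.Nat using (ℕ; suc)
open import Data.Fin using (Fin) renaming (_<_ to _<ᶠ_)
open import Data.Rational using (ℚ; _<_; _>_)
open import Data.Product using (Σ; _×_)
open import Data.Sum using (_⊎_)
open import Data.Unit using (⊤)
open import Data.Empty using (⊥)
open import Relation.Nullary using (¬_)
open import Relation.Binary.PropositionalEquality using (_≡_)
open import Data.Vec.Functional using (_∷_)

-- Q^(d)_< : strictly increasing d-tuples of rationals (indices 0..d-1 for [d])
record Tup (d : ℕ) : Set where
  constructor tup
  field
    pt   : Fin d → ℚ
    incr : ∀ (i j : Fin d) → i <ᶠ j → pt i < pt j
open Tup public

_≈ᵗ_ : ∀ {d} → Tup d → Tup d → Set
a ≈ᵗ b = ∀ i → pt a i ≡ pt b i

-- First-order formulas in the language of Q_d (relations <_ij, =_ij, plus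
-- equality) with n free variables (de Bruijn indices).
data Formula (d : ℕ) : ℕ → Set where
  lt   : ∀ {n} → Fin d → Fin d → Fin n → Fin n → Formula d n
  eq   : ∀ {n} → Fin d → Fin d → Fin n → Fin n → Formula d n
  same : ∀ {n} → Fin n → Fin n → Formula d n
  tt ff : ∀ {n} → Formula d n
  not  : ∀ {n} → Formula d n → Formula d n
  _and_ _or_ _imp_ : ∀ {n} → Formula d n → Formula d n → Formula d n
  ex all : ∀ {n} → Formula d (suc n) → Formula d n

Sat : ∀ {d n} → Formula d n → (Fin n → Tup d) → Set
Sat (lt i j x y) ρ = pt (ρ x) i < pt (ρ y) j
Sat (eq i j x y) ρ = pt (ρ x) i ≡ pt (ρ y) j
Sat (same x y) ρ = ρ x ≈ᵗ ρ y
Sat tt ρ = ⊤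
Sat ff ρ = ⊥
Sat (not φ) ρ = ¬ Sat φ ρ
Sat (φ and ψ) ρ = Sat φ ρ × Sat ψ ρ
Sat (φ or ψ) ρ = Sat φ ρ ⊎ Sat ψ ρ
Sat (φ imp ψ) ρ = Sat φ ρ → Sat ψ ρ
Sat {d} (ex φ) ρ = Σ (Tup d) λ t → Sat φ (t ∷ ρ)
Sat {d} (all φ) ρ = (t : Tup d) → Sat φ (t ∷ ρ)

Definable : ∀ {d} → (Tup d → Tup d → Set) → Set
Definable {d} R = Σ (Formula d 2) λ φ →
  ∀ (a b : Tup d) → (R a b → Sat φ (a ∷ (b ∷ λ ()))) × (Sat φ (a ∷ (b ∷ λ ())) → R a b)

record IsOrder {d} (R : Tup d → Tup d → Set) : Set where
  field
    irrefl : ∀ a → ¬ R a a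
    trans  : ∀ a b c → R a b → R b c → R a c
    total  : ∀ a b → ¬ (a ≈ᵗ b) → R a b ⊎ R b a

data Dir : Set where
  less greater : Dir

relOf : Dir → ℚ → ℚ → Set
relOf less x y = x < y
relOf greater x y = x > y

-- A relation definable in Q_d only sees the order type of the 2d coordinates of its two
-- arguments: satisfaction is invariant under order isomorphisms of finitely many rationals,
-- by a back-and-forth argument in the dense order (ℚ, <). For an interlaced pair (a, b),
-- i.e. a_i < b_j and b_i < a_j whenever i < j, this order type is determined by the signs
-- of b_k - a_k, so the definable order ≺ singles out a set of "increasing" sign vectors:
-- it contains exactly one of s and -s for s ≠ 0, and it is closed under adding vectors
-- (transitivity of ≺ through three pairwise interlaced tuples). Moving a single coordinate
-- k is increasing in one direction ε_k, and k ▷ l (moving k in direction ε_k while moving l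
-- against ε_l is increasing) is a strict total order. A sign vector is then increasing iff
-- its ▷-most significant nonzero coordinate moves in its direction, by adding the less
-- significant coordinates one at a time. Finally any two tuples are joined by a chain of
-- interlaced pairs with the same signs (linear interpolation in small steps), so a ≺ b iff
-- the ▷-most significant coordinate where a and b differ moves in its direction.

module Submission where

open import Data.Empty using (⊥-elim)
open import Data.Fin using (Fin; zero; suc; toℕ; remQuot; combine; punchIn) renaming (_<_ to _<ᶠ_)
import Data.Fin.Properties as Fin
open import Data.Fin.Permutation using (Permutation′; _⟨$⟩ʳ_)
import Data.Fin.Permutation as Perm
import Data.Integer as ℤ
import Data.Integer.Properties as ℤ
import Data.List as List
open import Data.List.Membership.Propositional using (_∉_)
open import Data.List.Membership.Propositional.Properties using (∈-allFin)
open import Data.List.Relation.Unary.Any using (here; there)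
open import Data.Maybe using (Maybe; just; nothing; maybe′)
open import Data.Nat using (ℕ; zero; suc; z≤n; s≤s)
import Data.Nat as ℕ
import Data.Nat.Properties as ℕ
import Data.Product
open import Data.Product using (Σ; ∃; _×_; _,_; proj₁; proj₂)
open import Data.Rational
  using (ℚ; mkℚ; *<*; _<_; _≤_; _+_; _-_; _*_; -_; _⊓_; _⊔_; 1/_; 0ℚ; 1ℚ;
         Positive; NonZero; positive; nonNegative)
open import Data.Rational.Literals using (fromℤ)
import Data.Rational.Properties as ℚ
open import Data.Rational.Solver using (module +-*-Solver)
open +-*-Solver using (solve; _:+_; _:-_; :-_; _:*_; _:=_; con)
import Data.Rational.Unnormalised as ℚᵘ
import Data.Rational.Unnormalised.Properties as ℚᵘ
import Data.Sum
open import Data.Sum using (_⊎_; inj₁; inj₂; [_,_]′)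
open import Data.Unit using (⊤; tt)
open import Data.Vec.Functional using (_∷_; updateAt)
open import Data.Vec.Functional.Properties
  using (updateAt-updates; updateAt-minimal; updateAt-updateAt; updateAt-id-local; map-updateAt)
open import Function using (_∘_; id; const; _⇔_; mk⇔; Equivalence)
open import Relation.Binary.Construct.Closure.Reflexive using (ReflClosure)
import Relation.Binary.Construct.Closure.Reflexive.Properties as Refl
open import Relation.Binary.Core using (Rel)
open import Relation.Binary.Definitions using (Total; Transitive; Trichotomous; tri<; tri≈; tri>)
open import Relation.Binary.PropositionalEquality using (_≡_; _≢_; refl; sym; trans; cong; subst; subst₂; _≗_)
open import Relation.Nullary using (¬_; yes; no; Dec; ¬?)
open import Relation.Nullary.Decidable using (decidable-stable)
open import Relation.Unary using (Pred; Decidable)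

open import Defs

open Equivalence using (to; from)

private
  variable
    d n : ℕ
    I J : Set

total⇒reflexive : ∀ {A : Set} {ℓ} {_≲_ : Rel A ℓ} → Total _≲_ → ∀ x → x ≲ x
total⇒reflexive total x = [ id , id ]′ (total x x)

greatest : ∀ {n ℓ p} {_≲_ : Rel (Fin n) ℓ} → Total _≲_ → Transitive _≲_ →
           {P : Pred (Fin n) p} → Decidable P →
           (∀ k → ¬ P k) ⊎ ∃ λ m → P m × ∀ k → P k → k ≲ m
greatest {zero} _ _ _ = inj₁ λ ()
greatest {suc n} {_≲_ = _≲_} total ≲-trans {P} P?
  with greatest {_≲_ = λ k l → suc k ≲ suc l} (λ k l → total (suc k) (suc l)) ≲-trans (P? ∘ suc) | P? zero
... | inj₁ ¬P | no ¬P₀ = inj₁ λ { zero → ¬P₀ ; (suc k) → ¬P k }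
... | inj₁ ¬P | yes P₀ =
  inj₂ (zero , P₀ , λ { zero _ → total⇒reflexive total zero ; (suc k) Pk → ⊥-elim (¬P k Pk) })
... | inj₂ (m , Pm , max) | no ¬P₀ = inj₂ (suc m , Pm , λ { zero P₀ → ⊥-elim (¬P₀ P₀) ; (suc k) → max k })
... | inj₂ (m , Pm , max) | yes P₀ with total zero (suc m)
...   | inj₁ 0≲m = inj₂ (suc m , Pm , λ { zero _ → 0≲m ; (suc k) → max k })
...   | inj₂ m≲0 =
  inj₂ (zero , P₀ , λ { zero _ → total⇒reflexive total zero ; (suc k) Pk → ≲-trans (max k Pk) m≲0 })

sort : ∀ {n ℓ} {_<_ : Rel (Fin n) ℓ} → Transitive _<_ → Trichotomous _≡_ _<_ →
       Σ (Permutation′ n) λ π → ∀ {i j} → i <ᶠ j → (π ⟨$⟩ʳ i) < (π ⟨$⟩ʳ j)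
sort {zero} _ _ = Perm.id , λ {i} → ⊥-elim (Fin.¬Fin0 i)
sort {suc n} {_<_ = _<_} <-trans compare
  with greatest {_≲_ = λ k m → ReflClosure _<_ m k} (λ k m → Data.Sum.swap (Refl.total compare k m))
                (λ k≲l l≲m → Refl.trans <-trans l≲m k≲l) {P = λ _ → ⊤} (λ _ → yes tt)
... | inj₁ empty = ⊥-elim (empty zero tt)
... | inj₂ (m , _ , least) with sort {_<_ = λ x y → punchIn m x < punchIn m y} <-trans compare′
  where
    compare′ : Trichotomous _≡_ (λ x y → punchIn m x < punchIn m y)
    compare′ x y with compare (punchIn m x) (punchIn m y)
    ... | tri< a ¬b ¬c = tri< a (¬b ∘ cong (punchIn m)) ¬c
    ... | tri≈ ¬a b ¬c = tri≈ ¬a (Fin.punchIn-injective m x y b) ¬c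
    ... | tri> ¬a ¬b c = tri> ¬a (¬b ∘ cong (punchIn m)) c
...   | π , π-mono = Perm.insert zero m π , mono
  where
    mono : ∀ {i j} → i <ᶠ j → (Perm.insert zero m π ⟨$⟩ʳ i) < (Perm.insert zero m π ⟨$⟩ʳ j)
    mono {zero}  {suc j} _ = [ (λ m≡k → ⊥-elim (Fin.punchInᵢ≢i m _ (sym m≡k))) , id ]′
                               (Refl.toSum (least (punchIn m (π ⟨$⟩ʳ j)) tt))
    mono {suc i} {suc j} (s≤s i<j) = π-mono i<j

record Finite (I : Set) : Set where
  field
    size      : ℕ
    enum      : Fin size → I
    enum-onto : ∀ u → ∃ λ k → enum k ≡ u
open Finite

finite-Maybe : Finite I → Finite (Maybe I)
finite-Maybe F = record { size = suc (size F) ; enum = enum′ ; enum-onto = onto }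
  where
    enum′ : Fin (suc (size F)) → Maybe _
    enum′ zero    = nothing
    enum′ (suc k) = just (enum F k)
    onto : ∀ u → ∃ λ k → enum′ k ≡ u
    onto nothing  = zero , refl
    onto (just u) with enum-onto F u
    ... | k , refl = suc k , refl

finite-Fin× : ∀ n d → Finite (Fin n × Fin d)
finite-Fin× n d = record
  { size = n ℕ.* d ; enum = remQuot d ; enum-onto = λ (x , i) → combine x i , Fin.remQuot-combine x i }

eventually-all : Finite I → (P : I → ℕ → Set) → (∀ u {m n} → m ℕ.≤ n → P u m → P u n) →
                 (∀ u → ∃ (P u)) → ∃ λ n → ∀ u → P u n
eventually-all {I} F P upward exists with go (size F) (enum F)
  where
    go : ∀ m (f : Fin m → I) → ∃ λ n → ∀ k → P (f k) n
    go zero    f = 0 , λ ()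
    go (suc m) f with exists (f zero) | go m (f ∘ suc)
    ... | n₀ , P₀ | n₁ , P₁ =
      n₀ ℕ.⊔ n₁ , λ { zero → upward _ (ℕ.m≤m⊔n n₀ n₁) P₀ ; (suc k) → upward _ (ℕ.m≤n⊔m n₀ n₁) (P₁ k) }
... | n , every = n , λ u → subst (λ v → P v n) (proj₂ (enum-onto F u)) (every (proj₁ (enum-onto F u)))

p<p+1 : ∀ p → p < p + 1ℚ
p<p+1 p = subst (_< p + 1ℚ) (ℚ.+-identityʳ p) (ℚ.+-monoʳ-< p (ℚ.positive⁻¹ 1ℚ))

p-1<p : ∀ p → p - 1ℚ < p
p-1<p p = subst (p - 1ℚ <_) (ℚ.+-identityʳ p) (ℚ.+-monoʳ-< p (ℚ.negative⁻¹ (- 1ℚ)))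

p<q⇒0<q-p : ∀ {p q} → p < q → 0ℚ < q - p
p<q⇒0<q-p {p} {q} p<q = subst (_< q - p) (ℚ.+-inverseʳ p) (ℚ.+-monoˡ-< (- p) p<q)

p≤q⇒0≤q-p : ∀ {p q} → p ≤ q → 0ℚ ≤ q - p
p≤q⇒0≤q-p {p} {q} p≤q = subst (_≤ q - p) (ℚ.+-inverseʳ p) (ℚ.+-monoˡ-≤ (- p) p≤q)

+-<-from-gap : ∀ {p q r} → r < q - p → p + r < q
+-<-from-gap {p} {q} {r} r<q-p =
  subst (p + r <_) (solve 2 (λ p q → p :+ (q :- p) := q) refl p q) (ℚ.+-monoʳ-< p r<q-p)

<-+-from-gap : ∀ {p q r} → - r < q - p → p < q + r
<-+-from-gap {p} {q} {r} -r<q-p = subst₂ _<_ (solve 2 (λ p r → (p :+ :- r) :+ r := p) refl p r) refl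
  (ℚ.+-monoˡ-< r (+-<-from-gap {p} {q} { - r} -r<q-p))

<-from-gap : ∀ {p q} → 0ℚ < q - p → p < q
<-from-gap {p} {q} 0<q-p = subst (_< q) (ℚ.+-identityʳ p) (+-<-from-gap 0<q-p)

*-pos : ∀ {p q} → 0ℚ < p → 0ℚ < q → 0ℚ < p * q
*-pos {p} {q} p>0 q>0 = subst (_< p * q) (ℚ.*-zeroʳ p) (ℚ.*-monoʳ-<-pos p {{positive p>0}} q>0)

⊓-pos : ∀ {p q} → 0ℚ < p → 0ℚ < q → 0ℚ < p ⊓ q
⊓-pos {p} {q} p>0 q>0 =
  [ (λ eq → subst (0ℚ <_) (sym eq) p>0) , (λ eq → subst (0ℚ <_) (sym eq) q>0) ]′ (ℚ.⊓-sel p q)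

convex-≥ : ∀ {p q μ α β} → 0ℚ ≤ p → 0ℚ ≤ q → μ ≤ α → μ ≤ β → (p + q) * μ ≤ p * α + q * β
convex-≥ {p} {q} {μ} {α} {β} p≥0 q≥0 μ≤α μ≤β = subst (_≤ p * α + q * β) (sym (ℚ.*-distribʳ-+ μ p q))
  (ℚ.+-mono-≤ (ℚ.*-monoˡ-≤-nonNeg p {{nonNegative p≥0}} μ≤α) (ℚ.*-monoˡ-≤-nonNeg q {{nonNegative q≥0}} μ≤β))

ι : ℕ → ℚ
ι n = fromℤ (ℤ.+ n)

ι-suc : ∀ n → ι (suc n) ≡ ι n + 1ℚ
ι-suc n = ℚ.toℚᵘ-injective (ℚᵘ.≃-trans (ℚᵘ.*≡* numerators) (ℚᵘ.≃-sym (ℚ.toℚᵘ-homo-+ (ι n) 1ℚ)))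
  where
    numerators : ℤ.+ suc n ℤ.* ℤ.+ 1 ≡ (ℤ.+ n ℤ.* ℤ.+ 1 ℤ.+ ℤ.+ 1) ℤ.* ℤ.+ 1
    numerators = cong (ℤ._* ℤ.+ 1)
      (trans (cong ℤ.+_ (ℕ.+-comm 1 n)) (cong (ℤ._+ ℤ.+ 1) (sym (ℤ.*-identityʳ (ℤ.+ n)))))

ι-mono-< : ∀ {m n} → m ℕ.< n → ι m < ι n
ι-mono-< {m} {n} m<n = *<* (subst₂ ℤ._<_ (sym (ℤ.*-identityʳ (ℤ.+ m))) (sym (ℤ.*-identityʳ (ℤ.+ n))) (ℤ.+<+ m<n))

ι-mono-≤ : ∀ {m n} → m ℕ.≤ n → ι m ≤ ι n
ι-mono-≤ m≤n with ℕ.m≤n⇒m<n∨m≡n m≤n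
... | inj₁ m<n  = ℚ.<⇒≤ (ι-mono-< m<n)
... | inj₂ refl = ℚ.≤-refl

ι-unbounded : ∀ p → ∃ λ n → p < ι n
ι-unbounded (mkℚ (ℤ.+ n) q _) = suc n , *<* (subst₂ ℤ._<_ (ℤ.pos-* n 1) (ℤ.pos-* (suc n) (suc q))
  (ℤ.+<+ (ℕ.<-≤-trans (subst (ℕ._< suc n) (sym (ℕ.*-identityʳ n)) (ℕ.n<1+n n)) (ℕ.m≤m*n (suc n) (suc q)))))
ι-unbounded (mkℚ ℤ.-[1+ n ] q _) = 0 , *<* ℤ.-<+

archimedean : ∀ p {μ} → 0ℚ < μ → ∃ λ n → p < ι n * μ
archimedean p {μ} μ>0 = N , subst (_< ι N * μ) cancel (ℚ.*-monoˡ-<-pos μ (proj₂ (ι-unbounded (p * 1/ μ))))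
  where
    instance
      μ-positive : Positive μ
      μ-positive = positive μ>0
      μ-nonZero : NonZero μ
      μ-nonZero = ℚ.pos⇒nonZero μ
    N = proj₁ (ι-unbounded (p * 1/ μ))
    cancel : p * 1/ μ * μ ≡ p
    cancel = trans (ℚ.*-assoc p (1/ μ) μ) (trans (cong (p *_) (ℚ.*-inverseˡ μ)) (ℚ.*-identityʳ p))

-- Order types and definable relations

_≅_ : (I → ℚ) → (I → ℚ) → Set
X ≅ Y = ∀ u v → X u < X v ⇔ Y u < Y v

≅-sym : {X Y : I → ℚ} → X ≅ Y → Y ≅ X
≅-sym X≅Y u v = mk⇔ (from (X≅Y u v)) (to (X≅Y u v))

≅-∘ : {X Y : I → ℚ} (h : J → I) → X ≅ Y → (X ∘ h) ≅ (Y ∘ h)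
≅-∘ h X≅Y u v = X≅Y (h u) (h v)

≅-≗ : {X X′ Y Y′ : I → ℚ} → X ≗ X′ → Y ≗ Y′ → X ≅ Y → X′ ≅ Y′
≅-≗ X≗X′ Y≗Y′ X≅Y u v
  rewrite sym (X≗X′ u) | sym (X≗X′ v) | sym (Y≗Y′ u) | sym (Y≗Y′ v) = X≅Y u v

≅-≡ : {X Y : I → ℚ} → X ≅ Y → ∀ {u v} → X u ≡ X v → Y u ≡ Y v
≅-≡ {X = X} {Y} X≅Y {u} {v} Xu≡Xv with ℚ.<-cmp (Y u) (Y v)
... | tri< Yu<Yv _ _ = ⊥-elim (ℚ.<-irrefl Xu≡Xv (from (X≅Y u v) Yu<Yv))
... | tri≈ _ Yu≡Yv _ = Yu≡Yv
... | tri> _ _ Yv<Yu = ⊥-elim (ℚ.<-irrefl (sym Xu≡Xv) (from (X≅Y v u) Yv<Yu))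

≅-scale : ∀ {q} {X : I → ℚ} → 0ℚ < q → X ≅ ((q *_) ∘ X)
≅-scale {q = q} q>0 u v =
  mk⇔ (ℚ.*-monoʳ-<-pos q {{positive q>0}}) (ℚ.*-cancelˡ-<-nonNeg q {{nonNegative (ℚ.<⇒≤ q>0)}})

separate : ∀ {m p q} (f : Fin m → ℚ) {L : Pred (Fin m) p} {U : Pred (Fin m) q} → Decidable L → Decidable U →
           (∀ {k l} → L k → U l → f k < f l) →
           ∃ λ y → (∀ {k} → L k → f k < y) × (∀ {k} → U k → y < f k)
separate f L? U? L<U
  with greatest {_≲_ = λ k l → f k ≤ f l} (λ k l → ℚ.≤-total (f k) (f l)) ℚ.≤-trans L?
     | greatest {_≲_ = λ k l → f l ≤ f k} (λ k l → ℚ.≤-total (f l) (f k)) (λ p q → ℚ.≤-trans q p) U?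
... | inj₂ (k , Lk , max) | inj₂ (l , Ul , min) =
  let y , fk<y , y<fl = ℚ.<-dense (L<U Lk Ul)
  in y , (λ Lk′ → ℚ.≤-<-trans (max _ Lk′) fk<y) , (λ Ul′ → ℚ.<-≤-trans y<fl (min _ Ul′))
... | inj₂ (k , Lk , max) | inj₁ ¬U =
  f k + 1ℚ , (λ Lk′ → ℚ.≤-<-trans (max _ Lk′) (p<p+1 (f k))) , (λ {l} Ul → ⊥-elim (¬U l Ul))
... | inj₁ ¬L | inj₂ (l , Ul , min) =
  f l - 1ℚ , (λ {k} Lk → ⊥-elim (¬L k Lk)) , (λ Ul′ → ℚ.<-≤-trans (p-1<p (f l)) (min _ Ul′))
... | inj₁ ¬L | inj₁ ¬U = 0ℚ , (λ {k} Lk → ⊥-elim (¬L k Lk)) , (λ {l} Ul → ⊥-elim (¬U l Ul))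

≅-extend : Finite I → {X Y : I → ℚ} → X ≅ Y → ∀ x → ∃ λ y → maybe′ X x ≅ maybe′ Y y
≅-extend F {X} {Y} X≅Y x with Fin.any? (λ k → X (enum F k) ℚ.≟ x)
... | yes (k , Xk≡x) = Y (enum F k) , ≅-≗ onX (λ { nothing → refl ; (just _) → refl }) (≅-∘ h X≅Y)
  where
    h : Maybe _ → _
    h = maybe′ id (enum F k)
    onX : X ∘ h ≗ maybe′ X x
    onX nothing  = Xk≡x
    onX (just _) = refl
... | no x∉X = y , λ
  { nothing  nothing  → mk⇔ (⊥-elim ∘ ℚ.<-irrefl refl) (⊥-elim ∘ ℚ.<-irrefl refl)
  ; nothing  (just v) → proj₂ (cut v)
  ; (just u) nothing  → proj₁ (cut u)
  ; (just u) (just v) → X≅Y u v }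
  where
    separation = separate (Y ∘ enum F) (λ k → X (enum F k) ℚ.<? x) (λ k → x ℚ.<? X (enum F k))
                          (λ Xk<x x<Xl → to (X≅Y _ _) (ℚ.<-trans Xk<x x<Xl))
    y = proj₁ separation

    below : ∀ u → X u < x → Y u < y
    below u Xu<x with enum-onto F u
    ... | k , refl = proj₁ (proj₂ separation) Xu<x

    above : ∀ u → x < X u → y < Y u
    above u x<Xu with enum-onto F u
    ... | k , refl = proj₂ (proj₂ separation) x<Xu

    cut : ∀ u → (X u < x ⇔ Y u < y) × (x < X u ⇔ y < Y u)
    cut u with ℚ.<-cmp (X u) x | enum-onto F u
    ... | tri< Xu<x _ x≮Xu | _ =
      mk⇔ (below u) (λ _ → Xu<x) , mk⇔ (⊥-elim ∘ x≮Xu) (λ y<Yu → ⊥-elim (ℚ.<-asym y<Yu (below u Xu<x)))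
    ... | tri≈ _ Xu≡x _ | k , refl = ⊥-elim (x∉X (k , Xu≡x))
    ... | tri> Xu≮x _ x<Xu | _ =
      mk⇔ (⊥-elim ∘ Xu≮x) (λ Yu<y → ⊥-elim (ℚ.<-asym Yu<y (above u x<Xu))) , mk⇔ (above u) (λ _ → x<Xu)

≅-extendⁿ : ∀ {k} → Finite I → {X Y : I → ℚ} → X ≅ Y → (p : Fin k → ℚ) →
            ∃ λ q → [ X , p ]′ ≅ [ Y , q ]′
≅-extendⁿ {k = zero} F X≅Y p = (λ ()) , ≅-≗ onI onI (≅-∘ [ id , (λ ()) ]′ X≅Y)
  where
    onI : ∀ {Z : _ → ℚ} {r : Fin 0 → ℚ} → Z ∘ [ id , (λ ()) ]′ ≗ [ Z , r ]′
    onI (inj₁ _) = refl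
    onI (inj₂ ())
≅-extendⁿ {k = suc k} F X≅Y p with ≅-extend F X≅Y (p zero)
... | y , X₊≅Y₊ with ≅-extendⁿ (finite-Maybe F) X₊≅Y₊ (p ∘ suc)
...   | q , iso = y ∷ q , ≅-≗ regroup regroup (≅-∘ h iso)
  where
    h : _ ⊎ Fin (suc k) → Maybe _ ⊎ Fin k
    h (inj₁ u)       = inj₁ (just u)
    h (inj₂ zero)    = inj₁ nothing
    h (inj₂ (suc i)) = inj₂ i
    regroup : ∀ {Z : _ → ℚ} {r : Fin (suc k) → ℚ} → [ maybe′ Z (r zero) , r ∘ suc ]′ ∘ h ≗ [ Z , r ]′
    regroup (inj₁ _)       = refl
    regroup (inj₂ zero)    = refl
    regroup (inj₂ (suc _)) = refl

config : (Fin n → Tup d) → Fin n × Fin d → ℚ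
config ρ (x , i) = pt (ρ x) i

≅-extendᵗ : {ρ ρ′ : Fin n → Tup d} → config ρ ≅ config ρ′ → (t : Tup d) →
            ∃ λ t′ → config (t ∷ ρ) ≅ config (t′ ∷ ρ′)
≅-extendᵗ {n} {d} ρ≅ρ′ t with ≅-extendⁿ (finite-Fin× n d) ρ≅ρ′ (pt t)
... | q , iso = tup q increasing , ≅-≗ split split (≅-∘ h iso)
  where
    increasing : ∀ i j → i <ᶠ j → q i < q j
    increasing i j i<j = to (iso (inj₂ i) (inj₂ j)) (incr t i j i<j)
    h : Fin (suc n) × Fin d → (Fin n × Fin d) ⊎ Fin d
    h (zero  , i) = inj₂ i
    h (suc x , i) = inj₁ (x , i)
    split : ∀ {σ : Fin n → Tup d} {s : Tup d} → [ config σ , pt s ]′ ∘ h ≗ config (s ∷ σ)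
    split (zero  , _) = refl
    split (suc _ , _) = refl

Sat-≅ : ∀ {n} (φ : Formula d n) {ρ ρ′ : Fin n → Tup d} → config ρ ≅ config ρ′ → Sat φ ρ → Sat φ ρ′
Sat-≅ (lt i j x y) ρ≅ρ′ = to (ρ≅ρ′ (x , i) (y , j))
Sat-≅ (eq i j x y) ρ≅ρ′ = ≅-≡ ρ≅ρ′
Sat-≅ (same x y)   ρ≅ρ′ = λ ρx≈ρy i → ≅-≡ ρ≅ρ′ (ρx≈ρy i)
Sat-≅ tt           ρ≅ρ′ = id
Sat-≅ ff           ρ≅ρ′ = id
Sat-≅ (not φ)      ρ≅ρ′ = λ ¬φ φ′ → ¬φ (Sat-≅ φ (≅-sym ρ≅ρ′) φ′)
Sat-≅ (φ and ψ)    ρ≅ρ′ = Data.Product.map (Sat-≅ φ ρ≅ρ′) (Sat-≅ ψ ρ≅ρ′)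
Sat-≅ (φ or ψ)     ρ≅ρ′ = Data.Sum.map (Sat-≅ φ ρ≅ρ′) (Sat-≅ ψ ρ≅ρ′)
Sat-≅ (φ imp ψ)    ρ≅ρ′ = λ φ⇒ψ φ′ → Sat-≅ ψ ρ≅ρ′ (φ⇒ψ (Sat-≅ φ (≅-sym ρ≅ρ′) φ′))
Sat-≅ (ex φ)       ρ≅ρ′ (t , φt) with ≅-extendᵗ ρ≅ρ′ t
... | t′ , iso = t′ , Sat-≅ φ iso φt
Sat-≅ (all φ)      ρ≅ρ′ ∀φ t′ with ≅-extendᵗ (≅-sym ρ≅ρ′) t′
... | t , iso = Sat-≅ φ (≅-sym iso) (∀φ t)

pairConfig : Tup d → Tup d → Fin 2 × Fin d → ℚ
pairConfig a b (zero  , i) = pt a i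
pairConfig a b (suc _ , i) = pt b i

definable-≅ : {R : Tup d → Tup d → Set} → Definable R → ∀ {a b a′ b′} →
              pairConfig a b ≅ pairConfig a′ b′ → R a b → R a′ b′
definable-≅ (φ , R⇔φ) {a} {b} {a′} {b′} ab≅a′b′ Rab =
  proj₂ (R⇔φ a′ b′) (Sat-≅ φ (≅-≗ (sym ∘ pair) (sym ∘ pair) ab≅a′b′) (proj₁ (R⇔φ a b) Rab))
  where
    pair : ∀ {s t : Tup _} {f : Fin 0 → Tup _} → config (s ∷ t ∷ f) ≗ pairConfig s t
    pair (zero     , _) = refl
    pair (suc zero , _) = refl

data Sign : Set where
  down stay up : Sign

reverse : Sign → Sign
reverse down = up
reverse stay = stay
reverse up   = down

reverse-involutive : ∀ σ → reverse (reverse σ) ≡ σ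
reverse-involutive down = refl
reverse-involutive stay = refl
reverse-involutive up   = refl

stay? : ∀ σ → Dec (σ ≡ stay)
stay? down = no λ ()
stay? stay = yes refl
stay? up   = no λ ()

⌜_⌝ : Dir → Sign
⌜ less ⌝    = up
⌜ greater ⌝ = down

⌜⌝≢stay : ∀ R → ⌜ R ⌝ ≢ stay
⌜⌝≢stay less    ()
⌜⌝≢stay greater ()

reverse-⌜⌝≢stay : ∀ R → reverse ⌜ R ⌝ ≢ stay
reverse-⌜⌝≢stay less    ()
reverse-⌜⌝≢stay greater ()

sign-cases : ∀ σ R → σ ≡ stay ⊎ σ ≡ ⌜ R ⌝ ⊎ σ ≡ reverse ⌜ R ⌝
sign-cases down less    = inj₂ (inj₂ refl)
sign-cases down greater = inj₂ (inj₁ refl)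
sign-cases stay _       = inj₁ refl
sign-cases up   less    = inj₂ (inj₁ refl)
sign-cases up   greater = inj₂ (inj₂ refl)

SignOf : {A : Set} → (A → A → Set) → Sign → A → A → Set
SignOf _<_ down x y = y < x
SignOf _<_ stay x y = x ≡ y
SignOf _<_ up   x y = x < y

SignOf-map : ∀ {A B : Set} {_<_ : A → A → Set} {_<′_ : B → B → Set} (f : A → B) →
             (∀ {x y} → x < y → f x <′ f y) → ∀ σ {x y} → SignOf _<_ σ x y → SignOf _<′_ σ (f x) (f y)
SignOf-map f mono down = mono
SignOf-map f mono stay = cong f
SignOf-map f mono up   = mono

Moves : Sign → ℚ → ℚ → Set
Moves = SignOf _<_

moves-reverse : ∀ σ {x y} → Moves σ x y → Moves (reverse σ) y x
moves-reverse down = id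
moves-reverse stay = sym
moves-reverse up   = id

moves-unique : ∀ σ τ {x y} → Moves σ x y → Moves τ x y → σ ≡ τ
moves-unique down down _   _   = refl
moves-unique down stay y<x x≡y = ⊥-elim (ℚ.<-irrefl (sym x≡y) y<x)
moves-unique down up   y<x x<y = ⊥-elim (ℚ.<-asym x<y y<x)
moves-unique stay down x≡y y<x = ⊥-elim (ℚ.<-irrefl (sym x≡y) y<x)
moves-unique stay stay _   _   = refl
moves-unique stay up   x≡y x<y = ⊥-elim (ℚ.<-irrefl x≡y x<y)
moves-unique up   down x<y y<x = ⊥-elim (ℚ.<-asym x<y y<x)
moves-unique up   stay x<y x≡y = ⊥-elim (ℚ.<-irrefl x≡y x<y)
moves-unique up   up   _   _   = refl

moves-<-⇔ : ∀ σ {x y x′ y′} → Moves σ x y → Moves σ x′ y′ → x < y ⇔ x′ < y′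
moves-<-⇔ down y<x y′<x′ = mk⇔ (λ x<y → ⊥-elim (ℚ.<-asym x<y y<x)) (λ x′<y′ → ⊥-elim (ℚ.<-asym x′<y′ y′<x′))
moves-<-⇔ stay x≡y x′≡y′ = mk⇔ (⊥-elim ∘ ℚ.<-irrefl x≡y) (⊥-elim ∘ ℚ.<-irrefl x′≡y′)
moves-<-⇔ up   x<y x′<y′ = mk⇔ (λ _ → x′<y′) (λ _ → x<y)

moves-shift : ∀ σ {x y} p → Moves σ x y → Moves σ p (p + (y - x))
moves-shift σ {x} {y} p xy = subst (λ z → Moves σ z (p + (y - x))) (solve 2 (λ p x → p :+ (x :- x) := p) refl p x)
  (SignOf-map (λ z → p + (z - x)) (λ z<z′ → ℚ.+-monoʳ-< p (ℚ.+-monoˡ-< (- x) z<z′)) σ xy)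

sign : ∀ x y → ∃ λ σ → Moves σ x y
sign x y with ℚ.<-cmp x y
... | tri< x<y _ _ = up , x<y
... | tri≈ _ x≡y _ = stay , x≡y
... | tri> _ _ y<x = down , y<x

record HasSigns (s : Fin d → Sign) (a b : Tup d) : Set where
  constructor hasSigns
  field moves : ∀ k → Moves (s k) (pt a k) (pt b k)
open HasSigns

signs : Tup d → Tup d → Fin d → Sign
signs a b k = proj₁ (sign (pt a k) (pt b k))

signs-correct : (a b : Tup d) → HasSigns (signs a b) a b
signs-correct a b = hasSigns λ k → proj₂ (sign (pt a k) (pt b k))

signs-≗ : ∀ {s t : Fin d → Sign} {a b} → s ≗ t → HasSigns s a b → HasSigns t a b
signs-≗ s≗t (hasSigns m) = hasSigns λ k → subst (λ σ → Moves σ _ _) (s≗t k) (m k)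

signs-reverse : ∀ {s : Fin d → Sign} {a b} → HasSigns s a b → HasSigns (reverse ∘ s) b a
signs-reverse {s = s} (hasSigns m) = hasSigns λ k → moves-reverse (s k) (m k)

-- `Adds σ τ υ`: some numbers with signs σ and τ have a sum with sign υ.
data Adds : Sign → Sign → Sign → Set where
  stayˡ    : ∀ σ → Adds stay σ σ
  stayʳ    : ∀ σ → Adds σ stay σ
  repeat   : ∀ σ → Adds σ σ σ
  opposite : ∀ σ → Adds (reverse σ) σ stay

adds-≡ : ∀ {σ σ′ τ τ′ υ υ′} → σ ≡ σ′ → τ ≡ τ′ → υ ≡ υ′ → Adds σ′ τ′ υ′ → Adds σ τ υ
adds-≡ refl refl refl a = a

-- Interlaced pairs

record Interlaced (a b : Tup d) : Set where
  constructor interlaced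
  field interlace : ∀ {i j} → i <ᶠ j → pt a i < pt b j × pt b i < pt a j
open Interlaced

interlaced-sym : ∀ {a b : Tup d} → Interlaced a b → Interlaced b a
interlaced-sym ab = interlaced λ i<j → proj₂ (interlace ab i<j) , proj₁ (interlace ab i<j)

incr-⇔ : (a a′ : Tup d) → ∀ i j → pt a i < pt a j ⇔ pt a′ i < pt a′ j
incr-⇔ a a′ i j with Fin.<-cmp i j
... | tri< i<j _ _  = mk⇔ (λ _ → incr a′ i j i<j) (λ _ → incr a i j i<j)
... | tri≈ _ refl _ = mk⇔ (⊥-elim ∘ ℚ.<-irrefl refl) (⊥-elim ∘ ℚ.<-irrefl refl)
... | tri> _ _ j<i  = mk⇔ (λ ai<aj → ⊥-elim (ℚ.<-asym ai<aj (incr a j i j<i)))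
                          (λ a′i<a′j → ⊥-elim (ℚ.<-asym a′i<a′j (incr a′ j i j<i)))

interlaced-⇔ : ∀ {a b a′ b′ : Tup d} → Interlaced a b → Interlaced a′ b′ →
               (∀ k → pt a k < pt b k ⇔ pt a′ k < pt b′ k) → ∀ i j → pt a i < pt b j ⇔ pt a′ i < pt b′ j
interlaced-⇔ ab a′b′ diagonal i j with Fin.<-cmp i j
... | tri< i<j _ _  = mk⇔ (λ _ → proj₁ (interlace a′b′ i<j)) (λ _ → proj₁ (interlace ab i<j))
... | tri≈ _ refl _ = diagonal i
... | tri> _ _ j<i  = mk⇔ (λ ai<bj → ⊥-elim (ℚ.<-asym ai<bj (proj₂ (interlace ab j<i))))
                          (λ a′i<b′j → ⊥-elim (ℚ.<-asym a′i<b′j (proj₂ (interlace a′b′ j<i))))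

interlaced-≅ : ∀ {s} {a b a′ b′ : Tup d} → Interlaced a b → Interlaced a′ b′ →
               HasSigns s a b → HasSigns s a′ b′ → pairConfig a b ≅ pairConfig a′ b′
interlaced-≅ {s = s} {a} {b} {a′} {b′} ab a′b′ (hasSigns sab) (hasSigns sa′b′) = λ
  { (zero  , i) (zero  , j) → incr-⇔ a a′ i j
  ; (zero  , i) (suc _ , j) → interlaced-⇔ ab a′b′ (λ k → moves-<-⇔ (s k) (sab k) (sa′b′ k)) i j
  ; (suc _ , i) (zero  , j) → interlaced-⇔ (interlaced-sym ab) (interlaced-sym a′b′)
      (λ k → moves-<-⇔ (reverse (s k)) (moves-reverse (s k) (sab k)) (moves-reverse (s k) (sa′b′ k))) i j
  ; (suc _ , i) (suc _ , j) → incr-⇔ b b′ i j }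

signℕ : ℕ → ℕ → Sign
signℕ zero    zero    = stay
signℕ zero    (suc _) = up
signℕ (suc _) zero    = down
signℕ (suc m) (suc n) = signℕ m n

signℕ-correct : ∀ m n → SignOf ℕ._<_ (signℕ m n) m n
signℕ-correct zero    zero    = refl
signℕ-correct zero    (suc n) = s≤s z≤n
signℕ-correct (suc m) zero    = s≤s z≤n
signℕ-correct (suc m) (suc n) = SignOf-map suc s≤s (signℕ m n) (signℕ-correct m n)

rank : Sign → ℕ
rank down = 0
rank stay = 1
rank up   = 2

rank<3 : ∀ σ → rank σ ℕ.< 3
rank<3 down = s≤s z≤n
rank<3 stay = s≤s (s≤s z≤n)
rank<3 up   = s≤s (s≤s (s≤s z≤n))

gridPoint : Fin d → Sign → ℚ
gridPoint k o = ι (3 ℕ.* toℕ k ℕ.+ rank o)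

gridPoint-< : ∀ {i j : Fin d} → i <ᶠ j → ∀ o o′ → gridPoint i o < gridPoint j o′
gridPoint-< {i = i} {j} i<j o o′ = ι-mono-< (begin-strict
  3 ℕ.* toℕ i ℕ.+ rank o   <⟨ ℕ.+-monoʳ-< (3 ℕ.* toℕ i) (rank<3 o) ⟩
  3 ℕ.* toℕ i ℕ.+ 3        ≡⟨ ℕ.+-comm (3 ℕ.* toℕ i) 3 ⟩
  3 ℕ.+ 3 ℕ.* toℕ i        ≡⟨ ℕ.*-suc 3 (toℕ i) ⟨
  3 ℕ.* suc (toℕ i)        ≤⟨ ℕ.*-monoʳ-≤ 3 i<j ⟩
  3 ℕ.* toℕ j              ≤⟨ ℕ.m≤m+n (3 ℕ.* toℕ j) (rank o′) ⟩
  3 ℕ.* toℕ j ℕ.+ rank o′  ∎)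
  where open ℕ.≤-Reasoning

grid : (Fin d → Sign) → Tup d
grid o = tup (λ k → gridPoint k (o k)) (λ i j i<j → gridPoint-< i<j (o i) (o j))

grid-interlaced : ∀ (o o′ : Fin d → Sign) → Interlaced (grid o) (grid o′)
grid-interlaced o o′ = interlaced λ i<j → gridPoint-< i<j _ _ , gridPoint-< i<j _ _

grid-signs : ∀ (o o′ : Fin d → Sign) → HasSigns (λ k → signℕ (rank (o k)) (rank (o′ k))) (grid o) (grid o′)
grid-signs o o′ = hasSigns λ k →
  let m = rank (o k) ; n = rank (o′ k) ; c = 3 ℕ.* toℕ k in
  SignOf-map {_<_ = ℕ._<_} ι ι-mono-< (signℕ m n)
    (SignOf-map {_<_ = ℕ._<_} {_<′_ = ℕ._<_} (c ℕ.+_) (ℕ.+-monoʳ-< c) (signℕ m n) (signℕ-correct m n))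

adds-offsets : ∀ {σ τ υ} → Adds σ τ υ → Σ (Sign × Sign × Sign) λ (x , y , z) →
  signℕ (rank x) (rank y) ≡ σ × signℕ (rank y) (rank z) ≡ τ × signℕ (rank x) (rank z) ≡ υ
adds-offsets (stayˡ down)    = (stay , stay , down) , refl , refl , refl
adds-offsets (stayˡ stay)    = (stay , stay , stay) , refl , refl , refl
adds-offsets (stayˡ up)      = (stay , stay , up)   , refl , refl , refl
adds-offsets (stayʳ down)    = (up   , stay , stay) , refl , refl , refl
adds-offsets (stayʳ stay)    = (stay , stay , stay) , refl , refl , refl
adds-offsets (stayʳ up)      = (down , stay , stay) , refl , refl , refl
adds-offsets (repeat down)   = (up   , stay , down) , refl , refl , refl
adds-offsets (repeat stay)   = (stay , stay , stay) , refl , refl , refl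
adds-offsets (repeat up)     = (down , stay , up)   , refl , refl , refl
adds-offsets (opposite down) = (stay , up   , stay) , refl , refl , refl
adds-offsets (opposite stay) = (stay , stay , stay) , refl , refl , refl
adds-offsets (opposite up)   = (stay , down , stay) , refl , refl , refl

_[_]≔_ : {A : Set} → (Fin d → A) → Fin d → A → Fin d → A
s [ l ]≔ σ = updateAt s l (const σ)

≔-here : {A : Set} (s : Fin d → A) (l : Fin d) (σ : A) → (s [ l ]≔ σ) l ≡ σ
≔-here s l σ = updateAt-updates l s

≔-there : {A : Set} (s : Fin d → A) {l x : Fin d} (σ : A) → x ≢ l → (s [ l ]≔ σ) x ≡ s x
≔-there s σ x≢l = updateAt-minimal _ _ s x≢l

≔-restore : {A : Set} (s : Fin d → A) (l : Fin d) (σ : A) → (s [ l ]≔ σ) [ l ]≔ s l ≗ s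
≔-restore s l σ x = trans (updateAt-updateAt l s x) (updateAt-id-local l s refl x)

≔-unchanged : {A : Set} (s : Fin d → A) {l : Fin d} {σ : A} → s l ≡ σ → s [ l ]≔ σ ≗ s
≔-unchanged s sl≡σ = updateAt-id-local _ s (sym sl≡σ)

basis : Fin d → Sign → Fin d → Sign
basis k σ = (λ _ → stay) [ k ]≔ σ

basis-here : ∀ (k : Fin d) σ → basis k σ k ≡ σ
basis-here k σ = ≔-here _ k σ

basis-there : ∀ {k x : Fin d} σ → x ≢ k → basis k σ x ≡ stay
basis-there σ x≢k = ≔-there _ σ x≢k

reverse-basis : ∀ (k : Fin d) σ → reverse ∘ basis k σ ≗ basis k (reverse σ)
reverse-basis k σ = map-updateAt {f = reverse} {g = const σ} {h = const (reverse σ)} (λ _ → refl) (λ _ → stay) k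

basis-≔-stay : ∀ {k l : Fin d} σ → l ≢ k → basis k σ [ l ]≔ stay ≗ basis k σ
basis-≔-stay σ l≢k = ≔-unchanged _ (basis-there σ l≢k)

basis-adds : ∀ {k l : Fin d} σ τ → k ≢ l → ∀ x → Adds (basis k σ x) (basis l τ x) ((basis k σ [ l ]≔ τ) x)
basis-adds {k = k} {l} σ τ k≢l x with x Fin.≟ k | x Fin.≟ l
... | yes refl | _        =
  adds-≡ (basis-here x σ) (basis-there τ k≢l) (trans (≔-there _ τ k≢l) (basis-here x σ)) (stayʳ σ)
... | no x≢k   | yes refl = adds-≡ (basis-there σ x≢k) (basis-here x τ) (≔-here _ x τ) (stayˡ τ)
... | no x≢k   | no x≢l   =
  adds-≡ (basis-there σ x≢k) (basis-there τ x≢l) (trans (≔-there _ τ x≢l) (basis-there σ x≢k)) (stayˡ stay)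

update-adds : ∀ {s : Fin d → Sign} {m l} σ → m ≢ l → s l ≡ stay →
              ∀ x → Adds (s x) ((basis m (s m) [ l ]≔ σ) x) ((s [ l ]≔ σ) x)
update-adds {s = s} {m} {l} σ m≢l sl≡stay x with x Fin.≟ m | x Fin.≟ l
... | yes refl | _        = adds-≡ refl (trans (≔-there _ σ m≢l) (basis-here x (s x))) (≔-there s σ m≢l) (repeat (s x))
... | no x≢m   | yes refl = adds-≡ sl≡stay (≔-here _ x σ) (≔-here s x σ) (stayˡ σ)
... | no x≢m   | no x≢l   = adds-≡ refl (trans (≔-there _ σ x≢l) (basis-there _ x≢m)) (≔-there s σ x≢l) (stayʳ (s x))

opposed : (Fin d → Sign) → Fin d → Fin d → Fin d → Sign
opposed e k l = basis k (e k) [ l ]≔ reverse (e l)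

opposed-at-k : ∀ e {k l : Fin d} → k ≢ l → opposed e k l k ≡ e k
opposed-at-k e {k} k≢l = trans (≔-there _ _ k≢l) (basis-here k (e k))

opposed-at-l : ∀ e (k l : Fin d) → opposed e k l l ≡ reverse (e l)
opposed-at-l e k l = ≔-here _ l _

opposed-elsewhere : ∀ e {k l x : Fin d} → x ≢ k → x ≢ l → opposed e k l x ≡ stay
opposed-elsewhere e x≢k x≢l = trans (≔-there _ _ x≢l) (basis-there _ x≢k)

opposed-self : ∀ e (k : Fin d) → opposed e k k ≗ reverse ∘ basis k (e k)
opposed-self e k x with x Fin.≟ k
... | yes refl = trans (opposed-at-l e x x) (cong reverse (sym (basis-here x (e x))))
... | no x≢k   = trans (≔-there _ _ x≢k) (trans (basis-there _ x≢k) (cong reverse (sym (basis-there _ x≢k))))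

reverse-opposed : ∀ e {k l : Fin d} → k ≢ l → reverse ∘ opposed e k l ≗ opposed e l k
reverse-opposed e {k} {l} k≢l x with x Fin.≟ k | x Fin.≟ l
... | yes refl | _        = trans (cong reverse (opposed-at-k e k≢l)) (sym (opposed-at-l e l x))
... | no _     | yes refl = trans (cong reverse (opposed-at-l e k x))
                                  (trans (reverse-involutive (e x)) (sym (opposed-at-k e (k≢l ∘ sym))))
... | no x≢k   | no x≢l   = trans (cong reverse (opposed-elsewhere e x≢k x≢l)) (sym (opposed-elsewhere e x≢l x≢k))

opposed-adds : ∀ e {k l m : Fin d} → k ≢ l → l ≢ m → k ≢ m →
               ∀ x → Adds (opposed e k l x) (opposed e l m x) (opposed e k m x)
opposed-adds e {k} {l} {m} k≢l l≢m k≢m x with x Fin.≟ k | x Fin.≟ l | x Fin.≟ m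
... | yes refl | _        | _        =
  adds-≡ (opposed-at-k e k≢l) (opposed-elsewhere e k≢l k≢m) (opposed-at-k e k≢m) (stayʳ (e x))
... | no x≢k   | yes refl | _        =
  adds-≡ (opposed-at-l e k x) (opposed-at-k e l≢m) (opposed-elsewhere e x≢k l≢m) (opposite (e x))
... | no x≢k   | no x≢l   | yes refl =
  adds-≡ (opposed-elsewhere e x≢k x≢l) (opposed-at-l e l x) (opposed-at-l e k x) (stayˡ _)
... | no x≢k   | no x≢l   | no x≢m   =
  adds-≡ (opposed-elsewhere e x≢k x≢l) (opposed-elsewhere e x≢l x≢m) (opposed-elsewhere e x≢k x≢m) (stayˡ stay)

-- Interpolation

module Interpolation {d} (a b : Tup d) where

  δ : Fin d → ℚ
  δ k = pt b k - pt a k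

  μ : Fin d → Fin d → ℚ
  μ k l = (pt a l - pt a k) ⊓ (pt b l - pt b k)

  μ-pos : ∀ {k l} → k <ᶠ l → 0ℚ < μ k l
  μ-pos {k} {l} k<l = ⊓-pos (p<q⇒0<q-p (incr a k l k<l)) (p<q⇒0<q-p (incr b k l k<l))

  -- `Fine N`: after scaling a and b by N, steps by δ keep consecutive points interlaced.
  Fine-at : Fin d × Fin d → ℕ → Set
  Fine-at (k , l) N = k <ᶠ l → δ k < ι N * μ k l × - δ l < ι N * μ k l

  Fine : ℕ → Set
  Fine N = ∀ u → Fine-at u N

  Fine-upward : ∀ u {m n} → m ℕ.≤ n → Fine-at u m → Fine-at u n
  Fine-upward (k , l) m≤n fine-m k<l = Data.Product.map grow grow (fine-m k<l)
    where
      grow : ∀ {p} → p < ι _ * μ k l → p < ι _ * μ k l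
      grow p< = ℚ.<-≤-trans p< (ℚ.*-monoʳ-≤-nonNeg (μ k l) {{nonNegative (ℚ.<⇒≤ (μ-pos k<l))}} (ι-mono-≤ m≤n))

  Fine-exists : ∀ u → ∃ (Fine-at u)
  Fine-exists (k , l) with k Fin.<? l
  ... | no k≮l  = 0 , ⊥-elim ∘ k≮l
  ... | yes k<l with archimedean (δ k ⊔ - δ l) (μ-pos k<l)
  ...   | N , bound =
    N , λ _ → ℚ.≤-<-trans (ℚ.p≤p⊔q (δ k) (- δ l)) bound , ℚ.≤-<-trans (ℚ.p≤q⊔p (δ k) (- δ l)) bound

  fine : ∃ λ M → Fine (suc M)
  fine = let N , every = eventually-all (finite-Fin× d d) Fine-at Fine-upward Fine-exists
         in N , λ u → Fine-upward u (ℕ.n≤1+n N) (every u)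

  module Steps (M : ℕ) where

    position : ℕ → Fin d → ℚ
    position i k = ι (suc M) * pt a k + ι i * δ k

    position-suc : ∀ i k → position (suc i) k ≡ position i k + δ k
    position-suc i k rewrite ι-suc i = solve 4 (λ n p i r → n :* p :+ (i :+ con 1ℚ) :* r := (n :* p :+ i :* r) :+ r)
                                         refl (ι (suc M)) (pt a k) (ι i) (δ k)

    position-first : ∀ k → position 0 k ≡ ι (suc M) * pt a k
    position-first k = trans (cong (ι (suc M) * pt a k +_) (ℚ.*-zeroˡ (δ k))) (ℚ.+-identityʳ _)

    position-last : ∀ k → position (suc M) k ≡ ι (suc M) * pt b k
    position-last k = solve 3 (λ n p q → n :* p :+ n :* (q :- p) := n :* q) refl (ι (suc M)) (pt a k) (pt b k)

    position-gap : ∀ {i} → i ℕ.≤ suc M → ∀ {k l} → k <ᶠ l → ι (suc M) * μ k l ≤ position i l - position i k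
    position-gap {i} i≤N {k} {l} k<l = subst₂ _≤_ (cong (_* μ k l) weights) (sym combination)
      (convex-≥ (p≤q⇒0≤q-p (ι-mono-≤ i≤N)) (ι-mono-≤ z≤n)
                (ℚ.p⊓q≤p (pt a l - pt a k) (pt b l - pt b k)) (ℚ.p⊓q≤q (pt a l - pt a k) (pt b l - pt b k)))
      where
        weights : ι (suc M) - ι i + ι i ≡ ι (suc M)
        weights = solve 2 (λ n i → n :- i :+ i := n) refl (ι (suc M)) (ι i)
        combination : position i l - position i k ≡ (ι (suc M) - ι i) * (pt a l - pt a k) + ι i * (pt b l - pt b k)
        combination = solve 6 (λ n i p p′ q q′ → (n :* p′ :+ i :* (q′ :- p′)) :- (n :* p :+ i :* (q :- p))
                                                 := (n :- i) :* (p′ :- p) :+ i :* (q′ :- q))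
                        refl (ι (suc M)) (ι i) (pt a k) (pt a l) (pt b k) (pt b l)

    point : ∀ i → i ℕ.≤ suc M → Tup d
    point i i≤N = tup (position i) λ k l k<l →
      <-from-gap (ℚ.<-≤-trans (*-pos (ι-mono-< (s≤s z≤n)) (μ-pos k<l)) (position-gap i≤N k<l))

    points-interlaced : Fine (suc M) → ∀ {i} h h′ → Interlaced (point i h) (point (suc i) h′)
    points-interlaced fine-M {i} h h′ = interlaced λ {k} {l} k<l →
      subst (position i k <_) (sym (position-suc i l))
            (<-+-from-gap {position i k} {position i l}
              (ℚ.<-≤-trans (proj₂ (fine-M (k , l) k<l)) (position-gap h k<l))) ,
      subst (_< position i l) (sym (position-suc i k))
            (+-<-from-gap {position i k} {position i l}
              (ℚ.<-≤-trans (proj₁ (fine-M (k , l) k<l)) (position-gap h k<l)))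

    points-signs : ∀ {s} → HasSigns s a b → ∀ {i} h h′ → HasSigns s (point i h) (point (suc i) h′)
    points-signs {s} sab {i} h h′ = hasSigns λ k →
      subst (Moves (s k) (position i k)) (sym (position-suc i k)) (moves-shift (s k) (position i k) (moves sab k))

    ends : pairConfig (point 0 z≤n) (point (suc M) ℕ.≤-refl) ≅ pairConfig a b
    ends = ≅-sym (≅-≗ (λ _ → refl) scaled (≅-scale (ι-mono-< (s≤s z≤n))))
      where
        scaled : (ι (suc M) *_) ∘ pairConfig a b ≗ pairConfig (point 0 z≤n) (point (suc M) ℕ.≤-refl)
        scaled (zero  , k) = sym (position-first k)
        scaled (suc _ , k) = sym (position-last k)

module DefinableOrder {d : ℕ} (_≺_ : Tup d → Tup d → Set) (isOrder : IsOrder _≺_)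
                      (definable : Definable _≺_) where
  open IsOrder isOrder renaming (trans to ≺-trans)

  Increasing : (Fin d → Sign) → Set
  Increasing s = ∀ {a b} → Interlaced a b → HasSigns s a b → a ≺ b

  increasing-≗ : ∀ {s t} → s ≗ t → Increasing s → Increasing t
  increasing-≗ s≗t inc ab sab = inc ab (signs-≗ (sym ∘ s≗t) sab)

  increasing-from-pair : ∀ {s a b} → Interlaced a b → HasSigns s a b → a ≺ b → Increasing s
  increasing-from-pair ab sab a≺b a′b′ sa′b′ = definable-≅ definable (interlaced-≅ ab a′b′ sab sa′b′) a≺b

  private
    still : Fin d → Sign
    still _ = stay

    origin : Tup d
    origin = grid still

    origin-signs : ∀ s → HasSigns s origin (grid s)
    origin-signs s = signs-≗ (λ k → from-stay (s k)) (grid-signs still s)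
      where
        from-stay : ∀ σ → signℕ (rank stay) (rank σ) ≡ σ
        from-stay down = refl
        from-stay stay = refl
        from-stay up   = refl

  stay-not-increasing : ¬ Increasing (λ _ → stay)
  stay-not-increasing inc = irrefl origin (inc (grid-interlaced still still) (hasSigns λ _ → refl))

  increasing-antisym : ∀ s → Increasing s → ¬ Increasing (reverse ∘ s)
  increasing-antisym s inc inc′ = irrefl origin (≺-trans origin (grid s) origin
    (inc (grid-interlaced still s) (origin-signs s))
    (inc′ (grid-interlaced s still) (signs-reverse (origin-signs s))))

  increasing-total : ∀ s k → s k ≢ stay → Increasing s ⊎ Increasing (reverse ∘ s)
  increasing-total s k sk≢stay
    with total origin (grid s)
               (λ origin≈grid → sk≢stay (moves-unique _ stay (moves (origin-signs s) k) (origin≈grid k)))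
  ... | inj₁ o≺g = inj₁ (increasing-from-pair (grid-interlaced still s) (origin-signs s) o≺g)
  ... | inj₂ g≺o = inj₂ (increasing-from-pair (grid-interlaced s still) (signs-reverse (origin-signs s)) g≺o)

  -- Transitivity of ≺ through three pairwise interlaced grid tuples.
  increasing-adds : ∀ {s t u} → (∀ k → Adds (s k) (t k) (u k)) → Increasing s → Increasing t → Increasing u
  increasing-adds adds inc-s inc-t = increasing-from-pair (grid-interlaced x z) (signs-≗ xz (grid-signs x z))
    (≺-trans (grid x) (grid y) (grid z)
      (inc-s (grid-interlaced x y) (signs-≗ xy (grid-signs x y)))
      (inc-t (grid-interlaced y z) (signs-≗ yz (grid-signs y z))))
    where
      offsets = λ k → adds-offsets (adds k)
      x y z : Fin d → Sign
      x k = proj₁ (proj₁ (offsets k))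
      y k = proj₁ (proj₂ (proj₁ (offsets k)))
      z k = proj₂ (proj₂ (proj₁ (offsets k)))
      xy = λ k → proj₁ (proj₂ (offsets k))
      yz = λ k → proj₁ (proj₂ (proj₂ (offsets k)))
      xz = λ k → proj₂ (proj₂ (proj₂ (offsets k)))

  opaque
    direction : ∀ k → Σ Dir λ R → Increasing (basis k ⌜ R ⌝)
    direction k with increasing-total (basis k up) k (⌜⌝≢stay less ∘ trans (sym (basis-here k up)))
    ... | inj₁ inc = less , inc
    ... | inj₂ inc = greater , increasing-≗ (reverse-basis k up) inc

  ε : Fin d → Dir
  ε k = proj₁ (direction k)

  e : Fin d → Sign
  e k = ⌜ ε k ⌝

  e-increasing : ∀ k → Increasing (basis k (e k))
  e-increasing k = proj₂ (direction k)

  -- `k ▷ l`: coordinate k is more significant than coordinate l.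
  _▷_ : Fin d → Fin d → Set
  k ▷ l = Increasing (opposed e k l)

  ▷-irrefl : ∀ k → ¬ k ▷ k
  ▷-irrefl k k▷k = increasing-antisym (basis k (e k)) (e-increasing k) (increasing-≗ (opposed-self e k) k▷k)

  ▷⇒≢ : ∀ {k l} → k ▷ l → k ≢ l
  ▷⇒≢ {k} k▷l refl = ▷-irrefl k k▷l

  ▷-asym : ∀ {k l} → k ▷ l → ¬ l ▷ k
  ▷-asym {k} {l} k▷l l▷k =
    increasing-antisym (opposed e k l) k▷l (increasing-≗ (sym ∘ reverse-opposed e (▷⇒≢ k▷l)) l▷k)

  ▷-total : ∀ {k l} → k ≢ l → k ▷ l ⊎ l ▷ k
  ▷-total {k} {l} k≢l
    with increasing-total (opposed e k l) l (reverse-⌜⌝≢stay (ε l) ∘ trans (sym (opposed-at-l e k l)))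
  ... | inj₁ inc = inj₁ inc
  ... | inj₂ inc = inj₂ (increasing-≗ (reverse-opposed e k≢l) inc)

  ▷-trans : Transitive _▷_
  ▷-trans {k} {l} {m} k▷l l▷m with k Fin.≟ m
  ... | yes refl = ⊥-elim (▷-asym k▷l l▷m)
  ... | no k≢m   = increasing-adds (opposed-adds e (▷⇒≢ k▷l) (▷⇒≢ l▷m) k≢m) k▷l l▷m

  ▷-compare : Trichotomous _≡_ _▷_
  ▷-compare k l with k Fin.≟ l
  ... | yes refl = tri≈ (▷-irrefl k) refl (▷-irrefl k)
  ... | no k≢l with ▷-total k≢l
  ...   | inj₁ k▷l = tri< k▷l k≢l (▷-asym k▷l)
  ...   | inj₂ l▷k = tri> (▷-asym l▷k) k≢l l▷k

  ▷-leading : ∀ {k l} → k ▷ l → ∀ σ → Increasing (basis k (e k) [ l ]≔ σ)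
  ▷-leading {k} {l} k▷l σ with sign-cases σ (ε l)
  ... | inj₁ refl        = increasing-≗ (sym ∘ basis-≔-stay (e k) (▷⇒≢ k▷l ∘ sym)) (e-increasing k)
  ... | inj₂ (inj₁ refl) = increasing-adds (basis-adds (e k) (e l) (▷⇒≢ k▷l)) (e-increasing k) (e-increasing l)
  ... | inj₂ (inj₂ refl) = k▷l

  increasing-update : ∀ {s m l} → Increasing s → s m ≡ e m → m ▷ l → s l ≡ stay → ∀ σ → Increasing (s [ l ]≔ σ)
  increasing-update {s} {m} {l} inc sm≡em m▷l sl≡stay σ = increasing-adds (update-adds σ (▷⇒≢ m▷l) sl≡stay) inc
    (subst (λ τ → Increasing (basis m τ [ l ]≔ σ)) (sym sm≡em) (▷-leading m▷l σ))

  -- Add the coordinates other than m one at a time, starting from the basis vector at m.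
  increasing-if-dominant : ∀ {s m} → s m ≡ e m → (∀ l → s l ≢ stay → l ≢ m → m ▷ l) → Increasing s
  increasing-if-dominant {m = m} = go (List.allFin d) (λ x x∉ _ → ⊥-elim (x∉ (∈-allFin x)))
    where
      ∉-∷ : ∀ {x l} {xs : List.List (Fin d)} → x ≢ l → x ∉ xs → x ∉ l List.∷ xs
      ∉-∷ x≢l x∉xs (here refl)  = x≢l refl
      ∉-∷ x≢l x∉xs (there x∈xs) = x∉xs x∈xs

      go : ∀ (xs : List.List (Fin d)) {s} → (∀ x → x ∉ xs → x ≢ m → s x ≡ stay) → s m ≡ e m →
           (∀ l → s l ≢ stay → l ≢ m → m ▷ l) → Increasing s
      go List.[] {s} rest sm dom = increasing-≗ on-basis (e-increasing m)
        where
          on-basis : basis m (e m) ≗ s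
          on-basis x with x Fin.≟ m
          ... | yes refl = trans (basis-here x (e x)) (sym sm)
          ... | no x≢m   = trans (basis-there _ x≢m) (sym (rest x (λ ()) x≢m))
      go (l List.∷ xs) {s} rest sm dom with l Fin.≟ m
      ... | yes refl = go xs (λ x x∉xs x≢m → rest x (∉-∷ x≢m x∉xs) x≢m) sm dom
      ... | no l≢m = restore (stay? (s l)) (go xs rest′ sm′ dom′)
        where
          s′ = s [ l ]≔ stay
          rest′ : ∀ x → x ∉ xs → x ≢ m → s′ x ≡ stay
          rest′ x x∉xs x≢m with x Fin.≟ l
          ... | yes refl = ≔-here s x stay
          ... | no x≢l   = trans (≔-there s stay x≢l) (rest x (∉-∷ x≢l x∉xs) x≢m)
          sm′ : s′ m ≡ e m
          sm′ = trans (≔-there s stay (l≢m ∘ sym)) sm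
          dom′ : ∀ y → s′ y ≢ stay → y ≢ m → m ▷ y
          dom′ y s′y≢stay y≢m with y Fin.≟ l
          ... | yes refl = ⊥-elim (s′y≢stay (≔-here s y stay))
          ... | no y≢l   = dom y (s′y≢stay ∘ trans (≔-there s stay y≢l)) y≢m
          restore : Dec (s l ≡ stay) → Increasing s′ → Increasing s
          restore (yes sl≡stay) inc′ = increasing-≗ (≔-unchanged s sl≡stay) inc′
          restore (no sl≢stay)  inc′ = increasing-≗ (≔-restore s l stay)
                                         (increasing-update inc′ sm′ (dom l sl≢stay l≢m) (≔-here s l stay) (s l))

  opaque
    significance : Σ (Permutation′ d) λ π → ∀ {i j} → i <ᶠ j → (π ⟨$⟩ʳ i) ▷ (π ⟨$⟩ʳ j)
    significance = sort ▷-trans ▷-compare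

  π : Permutation′ d
  π = proj₁ significance

  Leading : (Fin d → Sign) → Fin d → Set
  Leading s j = (∀ i → i <ᶠ j → s (π ⟨$⟩ʳ i) ≡ stay) × s (π ⟨$⟩ʳ j) ≡ e (π ⟨$⟩ʳ j)

  leading⇒increasing : ∀ {s j} → Leading s j → Increasing s
  leading⇒increasing {s} {j} (before , at) = increasing-if-dominant at dominant
    where
      dominant : ∀ l → s l ≢ stay → l ≢ π ⟨$⟩ʳ j → (π ⟨$⟩ʳ j) ▷ l
      dominant l sl≢stay l≢πj with Fin.<-cmp (π Perm.⟨$⟩ˡ l) j
      ... | tri< i<j _ _  = ⊥-elim (sl≢stay (subst (λ x → s x ≡ stay) (Perm.inverseʳ π) (before _ i<j)))
      ... | tri≈ _ refl _ = ⊥-elim (l≢πj (sym (Perm.inverseʳ π)))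
      ... | tri> _ _ j<i  = subst ((π ⟨$⟩ʳ j) ▷_) (Perm.inverseʳ π) (proj₂ significance j<i)

  increasing⇒leading : ∀ {s} → Increasing s → ∃ (Leading s)
  increasing⇒leading {s} inc
    with greatest {_≲_ = λ i j → toℕ j ℕ.≤ toℕ i} (λ i j → Fin.≤-total j i)
                  (λ i≥j j≥k → Fin.≤-trans j≥k i≥j)
                  {P = λ i → s (π ⟨$⟩ʳ i) ≢ stay} (λ i → ¬? (stay? (s (π ⟨$⟩ʳ i))))
  ... | inj₁ none = ⊥-elim (stay-not-increasing (increasing-≗ all-stay inc))
    where
      all-stay : s ≗ λ _ → stay
      all-stay x = subst (λ y → s y ≡ stay) (Perm.inverseʳ π) (decidable-stable (stay? _) (none (π Perm.⟨$⟩ˡ x)))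
  ... | inj₂ (j , moves-j , first) with sign-cases (s (π ⟨$⟩ʳ j)) (ε (π ⟨$⟩ʳ j))
  ...   | inj₁ stays           = ⊥-elim (moves-j stays)
  ...   | inj₂ (inj₁ forward)  = j , before , forward
    where
      before : ∀ i → i <ᶠ j → s (π ⟨$⟩ʳ i) ≡ stay
      before i i<j = decidable-stable (stay? _) λ moves-i → ℕ.<⇒≱ i<j (first i moves-i)
  ...   | inj₂ (inj₂ backward) = ⊥-elim (increasing-antisym s inc (leading⇒increasing (before′ , at′)))
    where
      before′ : ∀ i → i <ᶠ j → reverse (s (π ⟨$⟩ʳ i)) ≡ stay
      before′ i i<j = cong reverse (decidable-stable (stay? _) λ moves-i → ℕ.<⇒≱ i<j (first i moves-i))
      at′ : reverse (s (π ⟨$⟩ʳ j)) ≡ e (π ⟨$⟩ʳ j)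
      at′ = trans (cong reverse backward) (reverse-involutive _)

  -- Chain (suc M) a ≺ … ≺ (suc M) b through interlaced steps with the signs of (a , b), then rescale.
  increasing⇒≺ : ∀ {s a b} → Increasing s → HasSigns s a b → a ≺ b
  increasing⇒≺ {s} {a} {b} inc sab = definable-≅ definable ends (chain M ℕ.≤-refl)
    where
      open Interpolation a b
      M = proj₁ fine
      open Steps M
      step : ∀ {i} h h′ → point i h ≺ point (suc i) h′
      step h h′ = inc (points-interlaced (proj₂ fine) h h′) (points-signs sab h h′)
      chain : ∀ i (h : suc i ℕ.≤ suc M) → point 0 z≤n ≺ point (suc i) h
      chain zero    h = step z≤n h
      chain (suc i) h = ≺-trans _ _ _ (chain i h′) (step h′ h)
        where h′ = ℕ.≤-trans (ℕ.n≤1+n _) h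

  ≺⇒increasing : ∀ {a b} → a ≺ b → Increasing (signs a b)
  ≺⇒increasing {a} {b} a≺b with Fin.any? (λ k → ¬? (stay? (signs a b k)))
  ... | yes (k , moves-k) with increasing-total (signs a b) k moves-k
  ...   | inj₁ inc = inc
  ...   | inj₂ inc =
    ⊥-elim (irrefl a (≺-trans a b a a≺b (increasing⇒≺ inc (signs-reverse (signs-correct a b)))))
  ≺⇒increasing {a} {b} a≺b | no none =
    ⊥-elim (irrefl a (definable-≅ definable (≅-≗ (λ _ → refl) b≗a (λ _ _ → mk⇔ id id)) a≺b))
    where
      b≗a : pairConfig a b ≗ pairConfig a a
      b≗a (zero  , k) = refl
      b≗a (suc _ , k) = sym (subst (λ σ → Moves σ (pt a k) (pt b k))
                                   (decidable-stable (stay? _) (λ moves-k → none (k , moves-k)))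
                                   (moves (signs-correct a b) k))

  R : Fin d → Dir
  R j = ε (π ⟨$⟩ʳ j)

  Lexicographic : Tup d → Tup d → Set
  Lexicographic a b = Σ (Fin d) λ j →
    (∀ i → i <ᶠ j → pt a (π ⟨$⟩ʳ i) ≡ pt b (π ⟨$⟩ʳ i)) × relOf (R j) (pt a (π ⟨$⟩ʳ j)) (pt b (π ⟨$⟩ʳ j))

  lexicographic⇔leading : ∀ a b → Lexicographic a b ⇔ ∃ (Leading (signs a b))
  lexicographic⇔leading a b = mk⇔
    (λ (j , before , at) → j , (λ i i<j → to (moves⇔signs stay _) (before i i<j)) ,
                              to (relOf⇔signs (R j) _) at)
    (λ (j , before , at) → j , (λ i i<j → from (moves⇔signs stay _) (before i i<j)) ,
                              from (relOf⇔signs (R j) _) at)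
    where
      moves⇔signs : ∀ σ k → Moves σ (pt a k) (pt b k) ⇔ signs a b k ≡ σ
      moves⇔signs σ k = mk⇔ (moves-unique _ σ (moves (signs-correct a b) k))
                            (λ eq → subst (λ τ → Moves τ (pt a k) (pt b k)) eq (moves (signs-correct a b) k))
      relOf⇔signs : ∀ D k → relOf D (pt a k) (pt b k) ⇔ signs a b k ≡ ⌜ D ⌝
      relOf⇔signs less    = moves⇔signs up
      relOf⇔signs greater = moves⇔signs down

  ≺⇔lexicographic : ∀ a b → a ≺ b ⇔ Lexicographic a b
  ≺⇔lexicographic a b = mk⇔
    (λ a≺b → from (lexicographic⇔leading a b) (increasing⇒leading (≺⇒increasing a≺b)))
    (λ lex → increasing⇒≺ (leading⇒increasing (proj₂ (to (lexicographic⇔leading a b) lex)))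
                          (signs-correct a b))

lemma4p35 : (d : ℕ) (≺ : Tup d → Tup d → Set) → IsOrder ≺ → Definable ≺ →
    Σ (Fin d → Dir) λ R → Σ (Permutation′ d) λ σ →
      ∀ (a b : Tup d) →
        (≺ a b → Σ (Fin d) λ j →
            (∀ i → i <ᶠ j → pt a (σ ⟨$⟩ʳ i) ≡ pt b (σ ⟨$⟩ʳ i))
            × relOf (R j) (pt a (σ ⟨$⟩ʳ j)) (pt b (σ ⟨$⟩ʳ j)))
        × ((Σ (Fin d) λ j →
            (∀ i → i <ᶠ j → pt a (σ ⟨$⟩ʳ i) ≡ pt b (σ ⟨$⟩ʳ i))
            × relOf (R j) (pt a (σ ⟨$⟩ʳ j)) (pt b (σ ⟨$⟩ʳ j))) → ≺ a b)
lemma4p35 d ≺ isOrder definable = R , π , λ a b → to (≺⇔lexicographic a b) , from (≺⇔lexicographic a b)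
  where open DefinableOrder ≺ isOrder definable
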